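{- Let $M\subseteq\mathbb{T}$ satisfy the standing hypothesis. Then the complete shell of $\rho^\forall_M$ for $\oplus$ is the map $X\mapsto\{\langle i,\sigma\rangle\in M\mid\exists k\in\mathbb{N}.\ M^{ -k}_{\downarrow\langle i,\sigma\rangle}\subseteq X\}$, where for $k\in\mathbb{Z}$, $M^{k}_{\downarrow\langle i,\sigma\rangle}=\{\langle j,\tau\rangle\in M\mid\tau_{j+k}=\sigma_{i+k}\}$.
   Context: $\mathbb{T}$ is the set of traces $\langle i,\sigma\rangle$, $i\in\mathbb{Z}$, $\sigma:\mathbb{Z}\to\mathbb{S}$ ($\sigma_k=\sigma(k)$); $X_{\downarrow s}=\{\langle i,\sigma\rangle\in X\mid\sigma_i=s\}$; $\oplus(X)=\{\langle i,\sigma\rangle\mid\langle i+1,\sigma\rangle\in X\}$, $\ominus(X)=\{\langle i,\sigma\rangle\mid\langle i-1,\sigma\rangle\in X\}$, $\curvearrowleft(X)=\{\langle -i,\lambda k.\sigma_{ -k}\rangle\mid\langle i,\sigma\rangle\in X\}$. Standing hypothesis on $M$: (i) $|M_{\downarrow s}|>1$ for all $s$; (ii) $\oplus(M)=M=\ominus(M)$ and $\oplus(\curvearrowleft M)=\curvearrowleft M=\ominus(\curvearrowleft M)$. $\rho^\forall_M(X)=\{\langle i,\sigma\rangle\in M\mid M_{\downarrow\sigma_i}\subseteq X\}$. Upper closure operators on $\langle\wp(\mathbb{T}),\supseteq\rangle$: maps monotone w.r.t. $\subseteq$, idempotent, with $\rho(X)\subseteq X$; $\rho\sqsubseteq\eta$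 iff $\rho(X)\supseteq\eta(X)$ for all $X$. $\rho$ is complete for $f$ if $\rho\circ f=\rho\circ f\circ\rho$. The complete shell of $\rho$ for $f$ is the $\sqsubseteq$-greatest closure $\eta\sqsubseteq\rho$ complete for $f$. -}

module Defs where

open import Level using (0ℓ)
open import Data.Nat using (ℕ)
open import Data.Integer using (ℤ; +_; _+_; -_; _-_; 1ℤ)
open import Data.Product using (Σ; ∃; _×_; _,_)
open import Relation.Unary using (Pred; _⊆_; _≐_; _∈_)
open import Relation.Binary.PropositionalEquality using (_≡_)
open import Relation.Nullary using (¬_)

module _ (S : Set) where

  -- a trace ⟨i,σ⟩ : current position i and an infinite two-sided sequence σ
  Trace : Set
  Trace = ℤ × (ℤ → S)

  TSet : Set₁
  TSet = Pred Trace 0ℓ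

  _↓_ : TSet → S → TSet
  (X ↓ s) (i , σ) = σ i ≡ s

  ⊕ : TSet → TSet
  ⊕ X (i , σ) = X (i + 1ℤ , σ)

  ⊖ : TSet → TSet
  ⊖ X (i , σ) = X (i - 1ℤ , σ)

  reflectT : Trace → Trace
  reflectT (i , σ) = (- i , λ k → σ (- k))

  ↶ : TSet → TSet
  ↶ X t = Σ Trace λ u → X u × (t ≡ reflectT u)

  -- X ↓ s (the subset, not just the predicate on a trace)
  Restrict : TSet → S → TSet
  Restrict X s t = X t × (X ↓ s) t

  record Standing (M : TSet) : Set where
    field
      nontriv : ∀ s → Σ Trace λ t → Σ Trace λ u →
                  Restrict M s t × Restrict M s u × ¬ (t ≡ u)
      ⊕M : ⊕ M ≐ M
      ⊖M : ⊖ M ≐ M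
      ⊕↶M : ⊕ (↶ M) ≐ ↶ M
      ⊖↶M : ⊖ (↶ M) ≐ ↶ M

  ρ∀ : TSet → TSet → TSet
  ρ∀ M X (i , σ) = M (i , σ) × (Restrict M (σ i) ⊆ X)

  -- upper closure operators on ⟨℘(𝕋), ⊇⟩
  record IsUClo (ρ : TSet → TSet) : Set₁ where
    field
      mono       : ∀ {X Y} → X ⊆ Y → ρ X ⊆ ρ Y
      idempotent : ∀ X → ρ (ρ X) ≐ ρ X
      reductive  : ∀ X → ρ X ⊆ X

  _⊑_ : (TSet → TSet) → (TSet → TSet) → Set₁
  ρ ⊑ η = ∀ X → η X ⊆ ρ X

  CompleteFor : (TSet → TSet) → (TSet → TSet) → Set₁
  CompleteFor ρ f = ∀ X → ρ (f X) ≐ ρ (f (ρ X))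

  record IsCompleteShell (ρ f η : TSet → TSet) : Set₂ where
    field
      isClo    : IsUClo η
      below    : η ⊑ ρ
      complete : CompleteFor η f
      greatest : ∀ η′ → IsUClo η′ → η′ ⊑ ρ → CompleteFor η′ f → η′ ⊑ η

  Mshift : TSet → ℤ → Trace → TSet
  Mshift M k (i , σ) (j , τ) = M (j , τ) × (τ (j + k) ≡ σ (i + k))

  shellMap : TSet → TSet → TSet
  shellMap M X t = M t × ∃ λ (k : ℕ) → Mshift M (- (+ k)) t ⊆ X

{-# OPTIONS --safe #-}
module Submission where

open import Defs
open import Data.Nat using (zero; suc)
open import Data.Integer using (ℤ; +_; _+_; -_; _-_; 0ℤ; 1ℤ)
open import Data.Integer.Properties using (+-identityʳ)
open import Data.Integer.Tactic.RingSolver using (solve-∀)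
open import Data.Product using (_×_; _,_; proj₁; proj₂)
open import Function using (_∘_)
open import Relation.Unary using (_⊆_; _≐_)
open import Relation.Unary.Properties using (≐-sym)
open import Relation.Binary.PropositionalEquality using (_≡_; refl; sym; trans; cong; subst)

-- The set M^{-k}_{↓⟨i,σ⟩} depends only on the symbol s = σ_{i-k}; write R_{-k}(s) for it.
-- Shift invariance of M gives R_{-(k+1)}(s) = ⊖ R_{-k}(s), so raising k by one moves the
-- shell map past ⊕, which makes it complete for ⊕. Conversely let η ⊑ ρ∀_M be complete for ⊕.
-- Since ⊕ ∘ ⊖ = id, completeness makes the fixpoints of η closed under ⊖; and R_0(s) = M↓s is
-- a fixpoint of ρ∀_M, hence of η. So η fixes every R_{-k}(s), and the shell map, which keeps
-- exactly the points lying in some R_{-k}(s) ⊆ X, is below η.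

i-1+1≡i : ∀ (i : ℤ) → i - 1ℤ + 1ℤ ≡ i
i-1+1≡i = solve-∀

i≡i+1-1 : ∀ (i : ℤ) → i ≡ i + 1ℤ - 1ℤ
i≡i+1-1 = solve-∀

-[1+k]≡-k-1 : ∀ k → - (+ suc k) ≡ - (+ k) - 1ℤ
-[1+k]≡-k-1 k = neg-1+ (+ k)
  where
  neg-1+ : ∀ (x : ℤ) → - (1ℤ + x) ≡ - x - 1ℤ
  neg-1+ = solve-∀

i+1-[1+k]≡i-k : ∀ i k → i + 1ℤ + - (+ suc k) ≡ i + - (+ k)
i+1-[1+k]≡i-k i k = cancel i (+ k)
  where
  cancel : ∀ (i x : ℤ) → i + 1ℤ + - (1ℤ + x) ≡ i + - x
  cancel = solve-∀

module _ {S : Set} where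

  Fixed : (TSet S → TSet S) → TSet S → Set
  Fixed η Z = Z ⊆ η Z

  ⊕-mono : ∀ {X Y : TSet S} → X ⊆ Y → ⊕ S X ⊆ ⊕ S Y
  ⊕-mono X⊆Y = X⊆Y

  ⊖⊕⊆ : ∀ {X : TSet S} → ⊖ S (⊕ S X) ⊆ X
  ⊖⊕⊆ {X} {i , σ} = subst (λ j → X (j , σ)) (i-1+1≡i i)

  ⊆⊕⊖ : ∀ {X : TSet S} → X ⊆ ⊕ S (⊖ S X)
  ⊆⊕⊖ {X} {i , σ} = subst (λ j → X (j , σ)) (i≡i+1-1 i)

  fixed-resp-≐ : ∀ {η Z Z′} → IsUClo S η → Z ≐ Z′ → Fixed η Z → Fixed η Z′
  fixed-resp-≐ clo (Z⊆Z′ , Z′⊆Z) Z-fixed = IsUClo.mono clo Z⊆Z′ ∘ Z-fixed ∘ Z′⊆Z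

  fixed-⊑ : ∀ {η ρ Z} → _⊑_ S η ρ → Fixed ρ Z → Fixed η Z
  fixed-⊑ η⊑ρ Z-fixed = η⊑ρ _ ∘ Z-fixed

  -- Z ⊆ η Z = η (⊕ (⊖ Z)) ⊆ η (⊕ (η (⊖ Z))) ⊆ ⊕ (η (⊖ Z)), then shift back by ⊖.
  fixed-⊖ : ∀ {η Z} → IsUClo S η → CompleteFor S η (⊕ S) → Fixed η Z → Fixed η (⊖ S Z)
  fixed-⊖ {η} {Z} clo complete Z-fixed =
    ⊖⊕⊆ {X = η (⊖ S Z)} ∘ reductive (⊕ S (η (⊖ S Z))) ∘ proj₁ (complete (⊖ S Z))
      ∘ mono (⊆⊕⊖ {X = Z}) ∘ Z-fixed
    where open IsUClo clo

  commutes⇒complete : ∀ {η f} → IsUClo S η → (∀ {X Y} → X ⊆ Y → f X ⊆ f Y) →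
                      (∀ X → η (f X) ⊆ f (η X)) → CompleteFor S η f
  commutes⇒complete {η} {f} clo f-mono commutes X =
    mono (commutes X) ∘ proj₂ (idempotent (f X)) , mono (f-mono (reductive X))
    where open IsUClo clo

module _ {S : Set} (M : TSet S) where

  -- Mshift S M k (i , σ) is definitionally RestrictAt k (σ (i + k)).
  RestrictAt : ℤ → S → TSet S
  RestrictAt k s (j , τ) = M (j , τ) × τ (j + k) ≡ s

  RestrictAt-zero : ∀ s → RestrictAt 0ℤ s ≐ Restrict S M s
  RestrictAt-zero s = (λ {(j , τ)} (m , e) → m , trans (cong τ (sym (+-identityʳ j))) e)
                    , (λ {(j , τ)} (m , e) → m , trans (cong τ (+-identityʳ j)) e)

  Restrict-fixed-ρ∀ : ∀ s → Fixed (ρ∀ S M) (Restrict S M s)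
  Restrict-fixed-ρ∀ s (m , e) = m , λ (m′ , e′) → m′ , trans e′ e

  Mshift-shared : ∀ {k t u} → Mshift S M k t u → Mshift S M k u ⊆ Mshift S M k t
  Mshift-shared (_ , e) (m , e′) = m , trans e′ e

  shellMap-isUClo : IsUClo S (shellMap S M)
  shellMap-isUClo = record { mono = mono ; idempotent = idempotent ; reductive = reductive }
    where
    mono : ∀ {X Y} → X ⊆ Y → shellMap S M X ⊆ shellMap S M Y
    mono X⊆Y (m , k , sub) = m , k , X⊆Y ∘ sub

    reductive : ∀ X → shellMap S M X ⊆ X
    reductive X (m , k , sub) = sub (m , refl)

    idempotent : ∀ X → shellMap S M (shellMap S M X) ≐ shellMap S M X
    idempotent X = reductive (shellMap S M X)
                 , λ {t} (m , k , sub) →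
                     m , k , λ u∈ → proj₁ u∈ , k , sub ∘ Mshift-shared {t = t} u∈

  shellMap⊑ρ∀ : _⊑_ S (shellMap S M) (ρ∀ S M)
  shellMap⊑ρ∀ X {i , σ} (m , sub) = m , 0 , λ {(j , τ)} (m′ , e) →
    sub (m′ , trans (cong τ (sym (+-identityʳ j))) (trans e (cong σ (+-identityʳ i))))

module _ {S : Set} {M : TSet S} (⊖M≐M : ⊖ S M ≐ M) where

  M⊆⊕M : M ⊆ ⊕ S M
  M⊆⊕M = proj₁ ⊖M≐M ∘ ⊆⊕⊖ {X = M}

  RestrictAt-pred : ∀ k s → RestrictAt M (k - 1ℤ) s ≐ ⊖ S (RestrictAt M k s)
  RestrictAt-pred k s = (λ {(l , π)} (m , e) → proj₂ ⊖M≐M m , trans (cong π (reassoc l k)) e)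
                      , (λ {(l , π)} (m , e) → proj₁ ⊖M≐M m , trans (cong π (sym (reassoc l k))) e)
    where
    reassoc : ∀ (l k : ℤ) → l - 1ℤ + k ≡ l + (k - 1ℤ)
    reassoc = solve-∀

  RestrictAt-suc : ∀ k s → RestrictAt M (- (+ suc k)) s ≐ ⊖ S (RestrictAt M (- (+ k)) s)
  RestrictAt-suc k s =
    subst (λ k′ → RestrictAt M k′ s ≐ ⊖ S (RestrictAt M (- (+ k)) s)) (sym (-[1+k]≡-k-1 k))
          (RestrictAt-pred (- (+ k)) s)

  shellMap-⊕ : ∀ X → shellMap S M (⊕ S X) ⊆ ⊕ S (shellMap S M X)
  shellMap-⊕ X {i , σ} (m , k , sub) = M⊆⊕M m , suc k , λ (m′ , e) →
    ⊖⊕⊆ {X = X} (sub (proj₁ (RestrictAt-suc k _) (m′ , trans e (cong σ (i+1-[1+k]≡i-k i k)))))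

  shellMap-complete : CompleteFor S (shellMap S M) (⊕ S)
  shellMap-complete = commutes⇒complete (shellMap-isUClo M) ⊕-mono shellMap-⊕

  module _ {η} (clo : IsUClo S η) (η⊑ρ∀ : _⊑_ S η (ρ∀ S M)) (complete : CompleteFor S η (⊕ S)) where

    RestrictAt-fixed : ∀ k s → Fixed η (RestrictAt M (- (+ k)) s)
    RestrictAt-fixed zero s =
      fixed-resp-≐ clo (≐-sym (RestrictAt-zero M s)) (fixed-⊑ η⊑ρ∀ (Restrict-fixed-ρ∀ M s))
    RestrictAt-fixed (suc k) s =
      fixed-resp-≐ clo (≐-sym (RestrictAt-suc k s)) (fixed-⊖ clo complete (RestrictAt-fixed k s))

    shellMap-greatest : _⊑_ S η (shellMap S M)
    shellMap-greatest X {i , σ} (m , k , sub) =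
      IsUClo.mono clo sub (RestrictAt-fixed k (σ (i + - (+ k))) (m , refl))

theorem10 : (S : Set) (M : TSet S) → Standing S M →
    IsCompleteShell S (ρ∀ S M) (⊕ S) (shellMap S M)
theorem10 S M st = record
  { isClo    = shellMap-isUClo M
  ; below    = shellMap⊑ρ∀ M
  ; complete = shellMap-complete ⊖M
  ; greatest = λ η clo η⊑ρ∀ complete → shellMap-greatest ⊖M clo η⊑ρ∀ complete
  }
  where open Standing st
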